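{- Let $G=(V_0\cup V_1,E)$ be a connected bipartite graph with partite sets $V_0,V_1$ that is an absolute retract of bipartite graphs. Then for every $i\in\{0,1\}$ and $v\in V_i$: (1) if $e_{H_i}(v)\le \mathrm{rad}(H_{1-i})-1$, then $e_G(v)=2e_{H_i}(v)+1=2\,\mathrm{rad}(H_{1-i})-1$; (2) if $e_{H_i}(v)=\mathrm{rad}(H_{1-i})$, then $e_G(v)=2\,\mathrm{rad}(H_{1-i})$ if and only if $N_G(v)\subseteq C(H_{1-i})$ and $d_{H_{1-i}}(u,N_G(v))\le \mathrm{rad}(H_{1-i})-1$ for every $u\in V_{1-i}$; otherwise $e_G(v)=2\,\mathrm{rad}(H_{1-i})+1$; (3) if $e_{H_i}(v)\ge \mathrm{rad}(H_{1-i})+1$, then $e_G(v)=2e_{H_i}(v)$ if and only if $e_{H_{1-i}}(u)<e_{H_i}(v)$ for some $u\in N_G(v)$; otherwise $e_G(v)=2e_{H_i}(v)+1$.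
   Context: Graphs are finite, simple (no loops), connected. For $i\in\{0,1\}$, $H_i$ is the graph with vertex set $V_i$ and an edge between every two distinct vertices having a common neighbour in $G$. $e_H(v)=\max_u d_H(u,v)$, $\mathrm{rad}(H)=\min_v e_H(v)$, $C(H)=\{v: e_H(v)=\mathrm{rad}(H)\}$, $d_H(u,S)=\min_{s\in S} d_H(u,s)$, $N_G(v)$ is the open neighbourhood. A subgraph $H$ of $G'$ is isometric if distances between vertices of $H$ agree in $H$ and $G'$, isochromatic if same chromatic number. A retract of $G'$ is the image of $G'$ under an idempotent edge-preserving map. An absolute retract of bipartite graphs is a bipartite graph $H$ such that whenever $H$ is an isometric and isochromatic subgraph of a bipartite graph $G'$, $H$ is a retract of $G'$. -}

module Defs where

open import Data.Nat using (ℕ; zero; suc; _+_; _*_; _≤_; _<_)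
open import Data.Fin using (Fin)
open import Data.Bool using (Bool; true; false; not; T)
open import Data.Product using (Σ; ∃; ∃-syntax; _×_; _,_)
open import Data.Unit using (⊤)
open import Relation.Nullary using (¬_)
open import Relation.Binary.PropositionalEquality using (_≡_; _≢_)
open import Function.Bundles using (_⇔_)

record Graph : Set where
  field
    n      : ℕ
    adj    : Fin n → Fin n → Bool
    sym    : ∀ x y → adj x y ≡ adj y x
    irrefl : ∀ x → adj x x ≡ false

open Graph public

Edge : (G : Graph) → Fin (n G) → Fin (n G) → Set
Edge G x y = T (adj G x y)

data Walk {V : Set} (R : V → V → Set) : V → V → ℕ → Set where
  here : ∀ {u} → Walk R u u zero
  step : ∀ {u w v k} → R u w → Walk R w v k → Walk R u v (suc k)

Dist : {V : Set} → (V → V → Set) → V → V → ℕ → Set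
Dist R u v k = Walk R u v k × (∀ m → m < k → ¬ Walk R u v m)

Ecc : {V : Set} → (V → V → Set) → (V → Set) → V → ℕ → Set
Ecc R P v k =
  (∀ u → P u → ∃[ j ] (Dist R u v j × j ≤ k)) × (∃[ u ] (P u × Dist R u v k))

Rad : {V : Set} → (V → V → Set) → (V → Set) → ℕ → Set
Rad R P r =
  (∃[ v ] (P v × Ecc R P v r)) × (∀ v → P v → ∀ k → Ecc R P v k → r ≤ k)

InCentre : {V : Set} → (V → V → Set) → (V → Set) → V → Set
InCentre R P v = P v × ∃[ r ] (Rad R P r × Ecc R P v r)

AllV : {V : Set} → V → Set
AllV _ = ⊤

DistG : (G : Graph) → Fin (n G) → Fin (n G) → ℕ → Set
DistG G = Dist (Edge G)

EccG : (G : Graph) → Fin (n G) → ℕ → Set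
EccG G = Ecc (Edge G) AllV

Connected : Graph → Set
Connected G = ∀ u v → ∃[ k ] Walk (Edge G) u v k

Colourable : Graph → ℕ → Set
Colourable G k = Σ (Fin (n G) → Fin k) λ c → ∀ x y → Edge G x y → c x ≢ c y

ChromaticNumber : Graph → ℕ → Set
ChromaticNumber G k = Colourable G k × (∀ j → j < k → ¬ Colourable G j)

IsBipartition : (G : Graph) → (Fin (n G) → Bool) → Set
IsBipartition G col = ∀ x y → Edge G x y → col x ≢ col y

Bipartite : Graph → Set
Bipartite G = Σ (Fin (n G) → Bool) (IsBipartition G)

IsSubgraphEmbedding : (H G' : Graph) → (Fin (n H) → Fin (n G')) → Set
IsSubgraphEmbedding H G' f =
  (∀ x y → f x ≡ f y → x ≡ y) × (∀ x y → Edge H x y → Edge G' (f x) (f y))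

Isometric : (H G' : Graph) → (Fin (n H) → Fin (n G')) → Set
Isometric H G' f = ∀ x y k → DistG H x y k ⇔ DistG G' (f x) (f y) k

Isochromatic : (H G' : Graph) → Set
Isochromatic H G' = ∀ k → ChromaticNumber H k ⇔ ChromaticNumber G' k

IsRetractVia : (H G' : Graph) → (Fin (n H) → Fin (n G')) → Set
IsRetractVia H G' f =
  Σ (Fin (n G') → Fin (n H)) λ r →
    (∀ x y → Edge G' x y → Edge H (r x) (r y)) × (∀ x → r (f x) ≡ x)

AbsoluteRetractOfBipartite : Graph → Set
AbsoluteRetractOfBipartite H =
  Bipartite H ×
  (∀ (G' : Graph) → Bipartite G' → (f : Fin (n H) → Fin (n G')) →
     IsSubgraphEmbedding H G' f → Isometric H G' f → Isochromatic H G' →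
     IsRetractVia H G' f)

-- H_i : vertex set V_i, edges between distinct vertices with a common
-- neighbour in G.

InPart : (G : Graph) → (Fin (n G) → Bool) → Bool → Fin (n G) → Set
InPart G col i x = col x ≡ i

HEdge : (G : Graph) → (Fin (n G) → Bool) → Bool → Fin (n G) → Fin (n G) → Set
HEdge G col i x y =
  col x ≡ i × col y ≡ i × x ≢ y × ∃[ w ] (Edge G x w × Edge G w y)

EccH : (G : Graph) → (Fin (n G) → Bool) → Bool → Fin (n G) → ℕ → Set
EccH G col i = Ecc (HEdge G col i) (InPart G col i)

RadH : (G : Graph) → (Fin (n G) → Bool) → Bool → ℕ → Set
RadH G col i = Rad (HEdge G col i) (InPart G col i)

CentreH : (G : Graph) → (Fin (n G) → Bool) → Bool → Fin (n G) → Set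
CentreH G col i = InCentre (HEdge G col i) (InPart G col i)

DistH : (G : Graph) → (Fin (n G) → Bool) → Bool → Fin (n G) → Fin (n G) → ℕ → Set
DistH G col i = Dist (HEdge G col i)

-- Same-side distances in G are twice the distances in the halved graph, so with e = e_{H_i}(v)
-- one has 2e ≤ e_G(v) ≤ 2e + 1, and e_G(v) = 2e exactly when the whole side V_{1-i} lies
-- within distance 2e - 1 of v, i.e. within H_{1-i}-distance e - 1 of the neighbourhood of v.
-- Comparing with the eccentricities of the neighbours of v in H_{1-i} gives (1), (2) and the
-- easy half of (3). For the other half of (3) we use that G is an absolute retract: glue to G
-- a hub adjacent to v and joined by a path of length 2ℓ to every vertex of V_{1-i}. If V_{1-i}
-- lies within 2ℓ + 1 of v and has diameter at most 4ℓ, this bipartite supergraph contains G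
-- isometrically, and a retraction onto G sends the hub to a neighbour of v within 2ℓ of all
-- of V_{1-i}.

module Submission where

open import Defs hiding (sym)
open import Data.Nat using (ℕ; zero; suc; _+_; _*_; _∸_; _⊓_; _<_; _≤_; _≤?_; z≤n; s≤s)
open import Data.Nat.Properties
open import Data.Nat.Induction using (<-rec)
open import Data.Fin using (Fin; zero; suc; toℕ; fromℕ<; splitAt; _↑ˡ_; _↑ʳ_; combine; remQuot)
import Data.Fin.Properties as Fin
open import Data.Bool using (Bool; not; T)
open import Data.Bool.Properties using (not-involutive; not-¬; ¬-not)
import Data.Bool.Properties as Bool
open import Data.Product using (∃; ∃-syntax; _×_; _,_; proj₁; proj₂)
open import Data.Sum using (_⊎_; inj₁; inj₂; [_,_])
open import Data.Empty using (⊥; ⊥-elim)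
open import Function using (_∘_)
open import Function.Bundles using (_⇔_; mk⇔; Equivalence; Inverse)
open import Relation.Nullary using (¬_; Dec; yes; no; does; contradiction)
open import Relation.Nullary.Decidable
  using (_×-dec_; _⊎-dec_; _→-dec_; ¬?; T?; does-⇔; dec-false; map′; decidable-stable)
open import Relation.Unary using (Decidable)
open import Relation.Binary.Definitions using (Symmetric; tri<; tri≈; tri>)
open import Relation.Binary.PropositionalEquality hiding ([_])

module _ {V : Set} {R : V → V → Set} where

  _▷_ : ∀ {a b c k} → Walk R a b k → R b c → Walk R a c (suc k)
  here ▷ e = step e here
  step e′ w ▷ e = step e′ (w ▷ e)

  _++ʷ_ : ∀ {a b c j k} → Walk R a b j → Walk R b c k → Walk R a c (j + k)
  here ++ʷ w′ = w′
  step e w ++ʷ w′ = step e (w ++ʷ w′)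

  reverseʷ : Symmetric R → ∀ {a b k} → Walk R a b k → Walk R b a k
  reverseʷ R-sym here = here
  reverseʷ R-sym (step e w) = reverseʷ R-sym w ▷ R-sym e

mapʷ : ∀ {V W : Set} {R : V → V → Set} {S : W → W → Set} (f : V → W) →
       (∀ {x y} → R x y → S (f x) (f y)) → ∀ {a b k} → Walk R a b k → Walk S (f a) (f b) k
mapʷ f f-hom here = here
mapʷ f f-hom (step e w) = step (f-hom e) (mapʷ f f-hom w)

Within : {V : Set} → (V → V → Set) → V → V → ℕ → Set
Within R u v m = ∃[ j ] (j ≤ m × Walk R u v j)

AllWithin : {V : Set} → (V → V → Set) → (V → Set) → V → ℕ → Set
AllWithin R P v m = ∀ u → P u → Within R u v m

within-weaken : ∀ {V : Set} {R : V → V → Set} {u v m m′} → m ≤ m′ → Within R u v m → Within R u v m′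
within-weaken m≤m′ (j , j≤m , w) = j , ≤-trans j≤m m≤m′ , w

lipschitz-walk : ∀ {V : Set} {R : V → V → Set} (F : V → ℕ) → (∀ {a b} → R a b → F b ≤ suc (F a)) →
                 ∀ {a b k} → Walk R a b k → F b ≤ F a + k
lipschitz-walk F lip {a} here = ≤-reflexive (sym (+-identityʳ (F a)))
lipschitz-walk F lip {a} (step {k = k} e w) = begin
  _             ≤⟨ lipschitz-walk F lip w ⟩
  _ + k         ≤⟨ +-monoˡ-≤ k (lip e) ⟩
  suc (F a) + k ≡⟨ sym (+-suc (F a) k) ⟩
  F a + suc k   ∎
  where open ≤-Reasoning

module _ {V : Set} {R : V → V → Set} where

  dist≤walk : ∀ {u v k m} → Dist R u v k → Walk R u v m → k ≤ m
  dist≤walk (_ , minimal) w = ≮⇒≥ (λ m<k → minimal _ m<k w)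

  dist-unique : ∀ {u v j k} → Dist R u v j → Dist R u v k → j ≡ k
  dist-unique dj dk = ≤-antisym (dist≤walk dj (proj₁ dk)) (dist≤walk dk (proj₁ dj))

  ecc⇒within : ∀ {P v k} → Ecc R P v k → ∀ {u} → P u → Within R u v k
  ecc⇒within (bounded , _) {u} pu with bounded u pu
  ... | j , (w , _) , j≤k = j , j≤k , w

  ecc≤bound : ∀ {P v k B} → Ecc R P v k → AllWithin R P v B → k ≤ B
  ecc≤bound (_ , (u , pu , d)) within with within u pu
  ... | j , j≤B , w = ≤-trans (dist≤walk d w) j≤B

module _ {P : ℕ → Set} (P? : Decidable P) where

  least : ∀ k → P k → ∃[ j ] (j ≤ k × P j × (∀ m → m < j → ¬ P m))
  least = <-rec _ search
    where
    search : ∀ k → (∀ {j} → j < k → P j → ∃[ l ] (l ≤ j × P l × (∀ m → m < l → ¬ P m))) →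
             P k → ∃[ j ] (j ≤ k × P j × (∀ m → m < j → ¬ P m))
    search k rec pk with anyUpTo? P? k
    ... | no none = k , ≤-refl , pk , λ m m<k pm → none (m , m<k , pm)
    ... | yes (j , j<k , pj) with rec j<k pj
    ...   | l , l≤j , pl , minimal = l , ≤-trans l≤j (<⇒≤ j<k) , pl , minimal

module FiniteWalks {m : ℕ} (R : Fin m → Fin m → Set) (R? : ∀ x y → Dec (R x y)) where

  walk? : ∀ k u v → Dec (Walk R u v k)
  walk? zero u v = map′ (λ { refl → here }) (λ { here → refl }) (u Fin.≟ v)
  walk? (suc k) u v =
    map′ (λ (w , e , p) → step e p) (λ { (step e p) → _ , e , p })
         (Fin.any? (λ w → R? u w ×-dec walk? k w v))

  within? : ∀ u v k → Dec (Within R u v k)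
  within? u v k = map′ (λ (j , j<k , w) → j , ≤-pred j<k , w) (λ (j , j≤k , w) → j , s≤s j≤k , w)
                       (anyUpTo? (λ j → walk? j u v) (suc k))

  within⇒dist : ∀ {u v k} → Within R u v k → ∃[ j ] (j ≤ k × Dist R u v j)
  within⇒dist {u} {v} (_ , i≤k , w) with least (λ j → walk? j u v) _ w
  ... | j , j≤i , wj , minimal = j , ≤-trans j≤i i≤k , (wj , minimal)

  ecc-exists : ∀ {P : Fin m → Set} → Decidable P → ∀ {v B} → (∃ P) →
               AllWithin R P v B → ∃[ k ] Ecc R P v k
  ecc-exists {P} P? {v} {B} (u₀ , pu₀) within
    with least (λ k → Fin.all? (λ u → P? u →-dec within? u v k)) B within
  ... | k , _ , bound , minimal = k , (all-within , attained bound minimal)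
    where
    all-within : ∀ u → P u → ∃[ j ] (Dist R u v j × j ≤ k)
    all-within u pu with within⇒dist (bound u pu)
    ... | j , j≤k , d = j , d , j≤k
    attained : ∀ {k} → AllWithin R P v k → (∀ l → l < k → ¬ AllWithin R P v l) → ∃[ u ] (P u × Dist R u v k)
    attained {zero} bound _ with bound u₀ pu₀
    ... | zero , _ , w = u₀ , pu₀ , (w , λ _ ())
    attained {suc k} bound minimal with Fin.any? (λ u → P? u ×-dec ¬? (within? u v k))
    ... | no none = ⊥-elim (minimal k ≤-refl λ u pu →
                      decidable-stable (within? u v k) (λ far → none (u , pu , far)))
    ... | yes (u , pu , far) with within⇒dist (bound u pu)
    ...   | j , j≤1+k , d with m≤n⇒m<n∨m≡n j≤1+k
    ...     | inj₁ j<1+k = ⊥-elim (far (j , ≤-pred j<1+k , proj₁ d))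
    ...     | inj₂ refl = u , pu , d

half-≤ : ∀ {j B} → 2 * j ≤ suc (2 * B) → j ≤ B
half-≤ {j} {B} 2j≤ = ≮⇒≥ λ B<j → 1+n≰n (begin
  suc (suc (2 * B)) ≡⟨ sym (*-suc 2 B) ⟩
  2 * suc B         ≤⟨ *-monoʳ-≤ 2 B<j ⟩
  2 * j             ≤⟨ 2j≤ ⟩
  suc (2 * B)       ∎)
  where open ≤-Reasoning

<-predecessor : ∀ {r e} → r < e → ∃[ ℓ ] (e ≡ suc ℓ × r ≤ ℓ)
<-predecessor (s≤s r≤ℓ) = _ , refl , r≤ℓ

half-< : ∀ {j e} → suc (2 * j) ≤ 2 * e → j < e
half-< {j} 2j+1≤ = ≰⇒> λ e≤j → 1+n≰n (≤-trans 2j+1≤ (*-monoʳ-≤ 2 e≤j))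

double-< : ∀ {j e} → j < e → suc (2 * j) < 2 * e
double-< {j} {e} j<e = begin-strict
  suc (2 * j)       <⟨ n<1+n _ ⟩
  suc (suc (2 * j)) ≡⟨ sym (*-suc 2 j) ⟩
  2 * suc j         ≤⟨ *-monoʳ-≤ 2 j<e ⟩
  2 * e             ∎
  where open ≤-Reasoning

SideWithin : (G : Graph) → (Fin (n G) → Bool) → Bool → Fin (n G) → ℕ → Set
SideWithin G col c = AllWithin (Edge G) (λ u → col u ≡ c)

side-within-weaken : ∀ {G col c v m m′} → m ≤ m′ → SideWithin G col c v m → SideWithin G col c v m′
side-within-weaken m≤m′ within u cu = within-weaken m≤m′ (within u cu)

-- Halved graphs

module Halved (G : Graph) (col : Fin (n G) → Bool) (bip : IsBipartition G col) where

  E : Fin (n G) → Fin (n G) → Set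
  E = Edge G

  E? : ∀ x y → Dec (E x y)
  E? x y = T? (adj G x y)

  E-sym : Symmetric E
  E-sym {x} {y} = subst T (Graph.sym G x y)

  col-flip : ∀ {x y} → E x y → col y ≡ not (col x)
  col-flip {x} {y} e = ¬-not (bip x y e ∘ sym)

  H : Bool → Fin (n G) → Fin (n G) → Set
  H = HEdge G col

  H? : ∀ c x y → Dec (H c x y)
  H? c x y = (col x Bool.≟ c) ×-dec (col y Bool.≟ c) ×-dec ¬? (x Fin.≟ y) ×-dec
             Fin.any? (λ w → E? x w ×-dec E? w y)

  H-sym : ∀ {c} → Symmetric (H c)
  H-sym (cx , cy , x≢y , w , e₁ , e₂) = cy , cx , x≢y ∘ sym , w , E-sym e₂ , E-sym e₁

  module GW = FiniteWalks E E?
  module HW (c : Bool) = FiniteWalks (H c) (H? c)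

  halved⇒walk : ∀ {c x y j} → Walk (H c) x y j → Walk E x y (2 * j)
  halved⇒walk here = here
  halved⇒walk {x = x} {y} {suc j} (step (_ , _ , _ , _ , e₁ , e₂) w) =
    subst (Walk E x y) (sym (*-suc 2 j)) (step e₁ (step e₂ (halved⇒walk w)))

  col-two-step : ∀ {x w y} → E x w → E w y → col y ≡ col x
  col-two-step {x} e₁ e₂ = trans (col-flip e₂) (trans (cong not (col-flip e₁)) (not-involutive (col x)))

  walk⇒halved : ∀ {c x y m} → Walk E x y m → col x ≡ c → col y ≡ c → ∃[ j ] (2 * j ≤ m × Walk (H c) x y j)
  walk⇒halved here _ _ = zero , z≤n , here
  walk⇒halved (step e here) refl cy = contradiction (trans (sym cy) (col-flip e)) (not-¬ refl)
  walk⇒halved {x = x} (step {w = w} e₁ (step {w = x′} {k = k} e₂ rest)) cx cy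
    with walk⇒halved rest (trans (col-two-step e₁ e₂) cx) cy | x Fin.≟ x′
  ... | j , 2j≤k , hw | yes refl = j , ≤-trans 2j≤k (≤-trans (n≤1+n k) (n≤1+n (suc k))) , hw
  ... | j , 2j≤k , hw | no x≢x′ =
    suc j , subst (_≤ suc (suc k)) (sym (*-suc 2 j)) (s≤s (s≤s 2j≤k)) ,
    step (cx , trans (col-two-step e₁ e₂) cx , x≢x′ , w , e₁ , e₂) hw

  walk⇒halved-to-neighbour : ∀ {i u v m} → col v ≡ i → col u ≡ not i → Walk E u v m →
    ∃[ s ] (E v s × ∃[ j ] (suc (2 * j) ≤ m × Walk (H (not i)) u s j))
  walk⇒halved-to-neighbour {i} cv cu w with reverseʷ E-sym w
  ... | here = contradiction (trans (sym cv) cu) (not-¬ refl)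
  ... | step e rest with walk⇒halved rest (trans (col-flip e) (cong not cv)) cu
  ...   | j , 2j≤ , hw = _ , e , j , s≤s 2j≤ , reverseʷ H-sym hw

  side-within-step : ∀ {c v s m} → E v s → SideWithin G col c v m → SideWithin G col c s (suc m)
  side-within-step e within u cu with within u cu
  ... | j , j≤m , w = suc j , s≤s j≤m , w ▷ e

  side-within⇒halved : ∀ {c s B} → col s ≡ c → SideWithin G col c s (suc (2 * B)) →
                       ∀ u → col u ≡ c → Within (H c) u s B
  side-within⇒halved cs within u cu with within u cu
  ... | l , l≤ , w with walk⇒halved w cu cs
  ...   | j , 2j≤l , hw = j , half-≤ (≤-trans 2j≤l l≤) , hw

  side-within⇒eccH : ∀ {c s} B → col s ≡ c → SideWithin G col c s (suc (2 * B)) →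
                     ∃[ k ] (k ≤ B × EccH G col c s k)
  side-within⇒eccH {c} {s} B cs within =
    let (k , ecc) = HW.ecc-exists c (λ u → col u Bool.≟ c) (s , cs) (side-within⇒halved {B = B} cs within)
    in k , ecc≤bound ecc (side-within⇒halved {B = B} cs within) , ecc

  side-within-odd : ∀ {i v ℓ} → col v ≡ i →
    SideWithin G col (not i) v (2 * suc ℓ) → SideWithin G col (not i) v (suc (2 * ℓ))
  side-within-odd {ℓ = ℓ} cv within u cu with within u cu
  ... | l , l≤ , w with walk⇒halved-to-neighbour cv cu w
  ...   | s , e , j , 2j+1≤l , hw =
    suc (2 * j) , s≤s (*-monoʳ-≤ 2 (≤-pred (half-< {j} (≤-trans 2j+1≤l l≤)))) , halved⇒walk hw ▷ E-sym e

  eccH⇒pairwise-within : ∀ {c w k} → EccH G col c w k →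
    ∀ u → col u ≡ c → SideWithin G col c u (2 * k + 2 * k)
  eccH⇒pairwise-within ecc u cu u′ cu′ with ecc⇒within ecc cu′ | ecc⇒within ecc cu
  ... | j′ , j′≤k , hw′ | j , j≤k , hw =
    2 * j′ + 2 * j , +-mono-≤ (*-monoʳ-≤ 2 j′≤k) (*-monoʳ-≤ 2 j≤k) ,
    halved⇒walk hw′ ++ʷ reverseʷ E-sym (halved⇒walk hw)

-- Helly's theorem for the intervals [a - 1, a + 1] and [b u - R, b u + R] of ℕ
interval-helly : ∀ {m} {P : Fin m → Set} → Decidable P → ∀ a R (b : Fin m → ℕ) →
  (∀ u → P u → b u ≤ a + suc R) → (∀ u → P u → a ≤ b u + suc R) →
  (∀ u u′ → P u → P u′ → b u ≤ b u′ + (R + R)) →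
  ∃[ c ] (c ≤ suc a × a ≤ suc c × (∀ u → P u → c ≤ b u + R × b u ≤ c + R))
interval-helly {P = P} P? a R b b≤ a≤ b-close
  with Fin.any? (λ u → P? u ×-dec (suc (a + R) ≤? b u))
... | yes (u₀ , pu₀ , above) = suc a , ≤-refl , ≤-trans (n≤1+n a) (n≤1+n _) , λ u pu →
  +-cancelʳ-≤ R (suc a) (b u + R) (≤-trans above (≤-trans (b-close u₀ u pu₀ pu) (≤-reflexive (sym (+-assoc (b u) R R))))) ,
  ≤-trans (b≤ u pu) (≤-reflexive (+-suc a R))
... | no none-above with Fin.any? (λ u → P? u ×-dec (suc (b u + R) ≤? a))
...   | no none-below = a , n≤1+n a , n≤1+n a , λ u pu →
  ≮⇒≥ (λ below → none-below (u , pu , below)) , ≮⇒≥ (λ above → none-above (u , pu , above))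
...   | yes (u₁ , pu₁ , below) = lower a below a≤
  where
  lower : ∀ a → suc (b u₁ + R) ≤ a → (∀ u → P u → a ≤ b u + suc R) →
          ∃[ c ] (c ≤ suc a × a ≤ suc c × (∀ u → P u → c ≤ b u + R × b u ≤ c + R))
  lower (suc a′) (s≤s below′) a≤′ = a′ , ≤-trans (n≤1+n a′) (n≤1+n _) , ≤-refl , λ u pu →
    ≤-pred (≤-trans (a≤′ u pu) (≤-reflexive (+-suc (b u) R))) ,
    ≤-trans (b-close u u₁ pu pu₁) (≤-trans (≤-reflexive (sym (+-assoc (b u₁) R R))) (+-monoˡ-≤ R below′))

potentials⇒isometric : ∀ {G G′ : Graph} (f : Fin (n G) → Fin (n G′)) →
  (∀ {x y} → Edge G x y → Edge G′ (f x) (f y)) →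
  (pot : Fin (n G) → Fin (n G′) → ℕ) →
  (∀ x {a b} → Edge G′ a b → pot x b ≤ suc (pot x a)) →
  (∀ x y → DistG G x y (pot x (f y))) →
  Isometric G G′ f
potentials⇒isometric {G} {G′} f f-edge pot pot-lipschitz pot-dist x y k = mk⇔ forward backward
  where
  pot-self : pot x (f x) ≡ 0
  pot-self = n≤0⇒n≡0 (dist≤walk (pot-dist x x) here)
  pot≤walk : ∀ {m} → Walk (Edge G′) (f x) (f y) m → pot x (f y) ≤ m
  pot≤walk w = subst (λ p → pot x (f y) ≤ p + _) pot-self (lipschitz-walk (pot x) (pot-lipschitz x) w)
  image : ∀ {m} → Walk (Edge G) x y m → Walk (Edge G′) (f x) (f y) m
  image = mapʷ f f-edge
  forward : DistG G x y k → DistG G′ (f x) (f y) k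
  forward d with dist-unique (pot-dist x y) d
  ... | refl = image (proj₁ d) , λ m m<k w → <⇒≱ m<k (pot≤walk w)
  backward : DistG G′ (f x) (f y) k → DistG G x y k
  backward d′ = subst (DistG G x y)
    (≤-antisym (pot≤walk (proj₁ d′)) (dist≤walk d′ (image (proj₁ (pot-dist x y))))) (pot-dist x y)

bipartite-edge⇒chromatic-2 : ∀ {X c} → IsBipartition X c → ∀ {x y} → Edge X x y →
                             ∀ k → ChromaticNumber X k ⇔ k ≡ 2
bipartite-edge⇒chromatic-2 {X} {c} bip {x} {y} e k = mk⇔ forward (λ { refl → two-colourable , fewer })
  where
  two-colourable : Colourable X 2
  two-colourable = from ∘ c , λ a b e′ eq →
    bip a b e′ (trans (sym (strictlyInverseˡ (c a))) (trans (cong to eq) (strictlyInverseˡ (c b))))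
    where open Inverse Fin.2↔Bool
  fewer : ∀ j → j < 2 → ¬ Colourable X j
  fewer zero _ (κ , _) with κ x
  ... | ()
  fewer (suc zero) _ (κ , proper) with κ x | κ y | proper x y e
  ... | zero | zero | κx≢κy = κx≢κy refl
  fewer (suc (suc _)) (s≤s (s≤s ()))
  forward : ChromaticNumber X k → k ≡ 2
  forward (colourable , minimal) with <-cmp k 2
  ... | tri< k<2 _ _ = ⊥-elim (fewer k k<2 colourable)
  ... | tri≈ _ k≡2 _ = k≡2
  ... | tri> _ _ 2<k = ⊥-elim (minimal 2 2<k two-colourable)

module Encoded {W : Set} {N : ℕ} (decode : Fin N → W) (encode : W → Fin N)
  (decode-encode : ∀ w → decode (encode w) ≡ w)
  {A : W → W → Set} (A? : ∀ x y → Dec (A x y)) (A-sym : Symmetric A) (A-irrefl : ∀ x → ¬ A x x) where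

  graph : Graph
  graph = record
    { n      = N
    ; adj    = λ a b → does (A? (decode a) (decode b))
    ; sym    = λ a b → does-⇔ (mk⇔ A-sym A-sym) (A? (decode a) (decode b)) (A? (decode b) (decode a))
    ; irrefl = λ a → dec-false (A? (decode a) (decode a)) (A-irrefl (decode a))
    }

  edge⇒adj : ∀ {a b} → Edge graph a b → A (decode a) (decode b)
  edge⇒adj {a} {b} e with A? (decode a) (decode b)
  ... | yes adjacent = adjacent

  adj⇒edge : ∀ {x y} → A x y → Edge graph (encode x) (encode y)
  adj⇒edge {x} {y} a with A? (decode (encode x)) (decode (encode y))
  ... | yes _ = _
  ... | no ¬a = ¬a (subst₂ A (sym (decode-encode x)) (sym (decode-encode y)) a)

  encode-injective : ∀ {x y} → encode x ≡ encode y → x ≡ y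
  encode-injective {x} {y} eq = trans (sym (decode-encode x)) (trans (cong decode eq) (decode-encode y))

m∸n≤1+m∸1+n : ∀ m n → m ∸ n ≤ suc (m ∸ suc n)
m∸n≤1+m∸1+n zero    zero    = z≤n
m∸n≤1+m∸1+n zero    (suc n) = z≤n
m∸n≤1+m∸1+n (suc m) zero    = ≤-refl
m∸n≤1+m∸1+n (suc m) (suc n) = m∸n≤1+m∸1+n m n

-- Neighbourhood Helly property of absolute retracts

module Gadget (G : Graph) (col : Fin (n G) → Bool) (bip : IsBipartition G col)
              {i : Bool} {v : Fin (n G)} (cv : col v ≡ i) (q : ℕ) where
  open Halved G col bip

  M R : ℕ
  M = suc (2 * q)
  R = suc M

  -- The hub is adjacent to v, and path u t is the vertex at distance toℕ t + 1 from the hub on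
  -- the hub–u path of length R; the paths of vertices u on the side of v stay detached.
  data Vertex : Set where
    old  : Fin (n G) → Vertex
    hub  : Vertex
    path : Fin (n G) → Fin M → Vertex

  Link : Vertex → Vertex → Set
  Link (old x)    (old y)     = E x y
  Link (old x)    hub         = x ≡ v
  Link hub        (path u t)  = toℕ t ≡ 0 × col u ≡ not i
  Link (path u t) (path u′ t′) = u ≡ u′ × suc (toℕ t) ≡ toℕ t′
  Link (path u t) (old y)     = u ≡ y × toℕ t ≡ 2 * q × col u ≡ not i
  Link _          _           = ⊥

  link? : ∀ a b → Dec (Link a b)
  link? (old x)    (old y)     = E? x y
  link? (old x)    hub         = x Fin.≟ v
  link? hub        (path u t)  = (toℕ t ≟ 0) ×-dec (col u Bool.≟ not i)
  link? (path u t) (path u′ t′) = (u Fin.≟ u′) ×-dec (suc (toℕ t) ≟ toℕ t′)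
  link? (path u t) (old y)     = (u Fin.≟ y) ×-dec (toℕ t ≟ 2 * q) ×-dec (col u Bool.≟ not i)
  link? (old _)    (path _ _)  = no λ ()
  link? hub        (old _)     = no λ ()
  link? hub        hub         = no λ ()
  link? (path _ _) hub         = no λ ()

  link-irrefl : ∀ a → ¬ Link a a
  link-irrefl (old x) e = subst T (Graph.irrefl G x) e
  link-irrefl (path u t) (_ , t+1≡t) = 1+n≢n t+1≡t

  data Adj (a b : Vertex) : Set where
    forth : Link a b → Adj a b
    back  : Link b a → Adj a b

  adj? : ∀ a b → Dec (Adj a b)
  adj? a b = map′ [ forth , back ] (λ { (forth l) → inj₁ l ; (back l) → inj₂ l }) (link? a b ⊎-dec link? b a)

  adj-sym : Symmetric Adj
  adj-sym (forth l) = back l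
  adj-sym (back l)  = forth l

  adj-irrefl : ∀ a → ¬ Adj a a
  adj-irrefl a (forth l) = link-irrefl a l
  adj-irrefl a (back l)  = link-irrefl a l

  decodeSum : Fin (n G) ⊎ Fin (suc (n G * M)) → Vertex
  decodeSum (inj₁ x)       = old x
  decodeSum (inj₂ zero)    = hub
  decodeSum (inj₂ (suc c)) = let (u , t) = remQuot M c in path u t

  decode : Fin (n G + suc (n G * M)) → Vertex
  decode a = decodeSum (splitAt (n G) a)

  encode : Vertex → Fin (n G + suc (n G * M))
  encode (old x)    = x ↑ˡ suc (n G * M)
  encode hub        = n G ↑ʳ zero
  encode (path u t) = n G ↑ʳ suc (combine u t)

  decode-encode : ∀ w → decode (encode w) ≡ w
  decode-encode (old x)    = cong decodeSum (Fin.splitAt-↑ˡ (n G) x _)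
  decode-encode hub        = cong decodeSum (Fin.splitAt-↑ʳ (n G) _ zero)
  decode-encode (path u t) = begin
    decode (encode (path u t))                 ≡⟨ cong decodeSum (Fin.splitAt-↑ʳ (n G) _ _) ⟩
    (let (u′ , t′) = remQuot M (combine u t) in path u′ t′) ≡⟨ cong (λ (u′ , t′) → path u′ t′) (Fin.remQuot-combine u t) ⟩
    path u t                                   ∎
    where open ≡-Reasoning

  open Encoded decode encode decode-encode adj? adj-sym adj-irrefl
    renaming (graph to G′)

  embed : Fin (n G) → Fin (n G′)
  embed x = encode (old x)

  embed-edge : ∀ {x y} → E x y → Edge G′ (embed x) (embed y)
  embed-edge e = adj⇒edge (forth e)

  embedding : IsSubgraphEmbedding G G′ embed
  embedding = (λ x y eq → old-injective (encode-injective eq)) , λ x y → embed-edge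
    where
    old-injective : ∀ {x y} → old x ≡ old y → x ≡ y
    old-injective refl = refl

  alternate : ℕ → Bool
  alternate zero    = i
  alternate (suc k) = not (alternate k)

  alternate-even : ∀ k → alternate (2 * k) ≡ i
  alternate-even zero    = refl
  alternate-even (suc k) = begin
    alternate (2 * suc k)             ≡⟨ cong alternate (*-suc 2 k) ⟩
    not (not (alternate (2 * k)))     ≡⟨ not-involutive _ ⟩
    alternate (2 * k)                 ≡⟨ alternate-even k ⟩
    i                                 ∎
    where open ≡-Reasoning

  colour : Vertex → Bool
  colour (old x)    = col x
  colour hub        = not i
  colour (path u t) = alternate (toℕ t)

  link-bichromatic : ∀ {a b} → Link a b → colour a ≢ colour b
  link-bichromatic {old x}    {old y}     e               = bip x y e
  link-bichromatic {old x}    {hub}       refl            = not-¬ cv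
  link-bichromatic {hub}      {path u t}  (t≡0 , _)       = not-¬ (cong alternate t≡0) ∘ sym
  link-bichromatic {path u t} {path _ t′} (_ , t+1≡t′)    eq =
    not-¬ refl (trans eq (sym (cong alternate t+1≡t′)))
  link-bichromatic {path u t} {old _}     (refl , t≡2q , cu) eq =
    not-¬ (trans (cong alternate t≡2q) (alternate-even q)) (trans eq cu)

  bipartite′ : Bipartite G′
  bipartite′ = colour ∘ decode , λ a b e → adj-bichromatic (edge⇒adj e)
    where
    adj-bichromatic : ∀ {a b} → Adj a b → colour a ≢ colour b
    adj-bichromatic {a} {b} (forth l) = link-bichromatic {a} {b} l
    adj-bichromatic {a} {b} (back l)  = link-bichromatic {b} {a} l ∘ sym

  module _ (conn : Connected G) (far : SideWithin G col (not i) v (suc R))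
           (close : ∀ u → col u ≡ not i → SideWithin G col (not i) u (R + R)) where

    distance : ∀ x y → ∃[ k ] DistG G x y k
    distance x y = let (k , _ , d) = GW.within⇒dist (_ , ≤-refl , proj₂ (conn x y)) in k , d

    dist : Fin (n G) → Fin (n G) → ℕ
    dist x y = proj₁ (distance x y)

    dist-spec : ∀ x y → DistG G x y (dist x y)
    dist-spec x y = proj₂ (distance x y)

    dist-extend : ∀ {x y y′ m} → Within E y y′ m → dist x y′ ≤ dist x y + m
    dist-extend {x} {y} (l , l≤m , w) =
      ≤-trans (dist≤walk (dist-spec x _) (proj₁ (dist-spec x y) ++ʷ w)) (+-monoʳ-≤ (dist x y) l≤m)

    -- The distance from x in G extends to a 1-Lipschitz function pot on the gadget, so the
    -- gadget creates no shortcuts between vertices of G.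
    module Potential (x : Fin (n G)) where

      hub-choice : ∃[ c ] (c ≤ suc (dist x v) × dist x v ≤ suc c ×
                           (∀ u → col u ≡ not i → c ≤ dist x u + R × dist x u ≤ c + R))
      hub-choice = interval-helly (λ u → col u Bool.≟ not i) (dist x v) R (dist x)
        (λ u cu → dist-extend (let (l , l≤ , w) = far u cu in l , l≤ , reverseʷ E-sym w))
        (λ u cu → dist-extend (far u cu))
        (λ u u′ cu cu′ → dist-extend (close u cu u′ cu′))

      c : ℕ
      c = proj₁ hub-choice

      c-near : ∀ u → col u ≡ not i → c ≤ dist x u + R × dist x u ≤ c + R
      c-near = proj₂ (proj₂ (proj₂ hub-choice))

      along : Fin (n G) → ℕ → ℕ
      along u k = (c + suc k) ⊓ (dist x u + (M ∸ k))

      pot : Vertex → ℕ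
      pot (old y)    = dist x y
      pot hub        = c
      pot (path u t) = along u (toℕ t)

      Close : ℕ → ℕ → Set
      Close p p′ = p′ ≤ suc p × p ≤ suc p′

      along-start : ∀ {u} → col u ≡ not i → Close c (along u 0)
      along-start {u} cu =
        ≤-trans (m⊓n≤m _ _) (≤-reflexive (+-comm c 1)) ,
        ⊓-glb (≤-trans (m≤m+n c _) (n≤1+n _)) (≤-trans (proj₁ (c-near u cu)) (≤-reflexive (+-suc (dist x u) M)))

      along-step : ∀ u k → Close (along u k) (along u (suc k))
      along-step u k =
        ⊓-mono-≤ (≤-reflexive (+-suc c (suc k)))
                 (≤-trans (+-monoʳ-≤ (dist x u) (∸-monoʳ-≤ M (n≤1+n k))) (n≤1+n _)) ,
        ⊓-mono-≤ (≤-trans (+-monoʳ-≤ c (n≤1+n _)) (n≤1+n _))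
                 (≤-trans (+-monoʳ-≤ (dist x u) (m∸n≤1+m∸1+n M k)) (≤-reflexive (+-suc (dist x u) _)))

      along-end : ∀ {u} → col u ≡ not i → Close (along u (2 * q)) (dist x u)
      along-end {u} cu =
        ⊓-glb (≤-trans (proj₂ (c-near u cu)) (≤-reflexive (+-suc c M))) (≤-trans (m≤m+n (dist x u) _) (n≤1+n _)) ,
        ≤-trans (m⊓n≤n _ _) (≤-reflexive (trans (cong (dist x u +_) (m+n∸n≡m 1 (2 * q))) (+-comm (dist x u) 1)))

      link-close : ∀ a b → Link a b → Close (pot a) (pot b)
      link-close (old y) (old y′) e = step-bound e , step-bound (E-sym e)
        where
        step-bound : ∀ {z z′} → E z z′ → dist x z′ ≤ suc (dist x z)
        step-bound {z} e′ = ≤-trans (dist-extend (1 , ≤-refl , step e′ here)) (≤-reflexive (+-comm (dist x z) 1))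
      link-close (old _) hub refl = proj₁ (proj₂ hub-choice) , proj₁ (proj₂ (proj₂ hub-choice))
      link-close hub (path u t) (t≡0 , cu) = subst (λ k → Close c (along u k)) (sym t≡0) (along-start cu)
      link-close (path u t) (path _ t′) (refl , t+1≡t′) =
        subst (λ k → Close (along u (toℕ t)) (along u k)) t+1≡t′ (along-step u (toℕ t))
      link-close (path u t) (old _) (refl , t≡2q , cu) =
        subst (λ k → Close (along u k) (dist x u)) (sym t≡2q) (along-end cu)

    isometric : Isometric G G′ embed
    isometric = potentials⇒isometric {G} {G′} embed (λ {x} {y} → embed-edge {x} {y}) (λ x → Potential.pot x ∘ decode) lipschitz pot-dist
      where
      lipschitz : ∀ x {a b} → Edge G′ a b → Potential.pot x (decode b) ≤ suc (Potential.pot x (decode a))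
      lipschitz x {a} {b} e with edge⇒adj e
      ... | forth l = proj₁ (Potential.link-close x (decode a) (decode b) l)
      ... | back l  = proj₂ (Potential.link-close x (decode b) (decode a) l)
      pot-dist : ∀ x y → DistG G x y (Potential.pot x (decode (embed y)))
      pot-dist x y = subst (λ w → DistG G x y (Potential.pot x w)) (sym (decode-encode (old y))) (dist-spec x y)

    along-path : ∀ {u} → col u ≡ not i → ∀ d (t : Fin M) → toℕ t + d ≡ 2 * q → Walk Adj (path u t) (old u) (suc d)
    along-path cu zero t t+0≡2q = step (forth (refl , trans (sym (+-identityʳ _)) t+0≡2q , cu)) here
    along-path cu (suc d) t t+1+d≡2q =
      step (forth (refl , sym (Fin.toℕ-fromℕ< t+1<M)))
           (along-path cu d (fromℕ< t+1<M) (trans (cong (_+ d) (Fin.toℕ-fromℕ< t+1<M)) (trans (sym (+-suc _ d)) t+1+d≡2q)))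
      where
      t+1<M : suc (toℕ t) < M
      t+1<M = s≤s (≤-trans (m≤m+n (suc (toℕ t)) d) (≤-reflexive (trans (sym (+-suc (toℕ t) d)) t+1+d≡2q)))

    hub-walk : ∀ {u} → col u ≡ not i → Walk Adj hub (old u) R
    hub-walk cu = step (forth (refl , cu)) (along-path cu (2 * q) zero refl)

    module _ (ar : AbsoluteRetractOfBipartite G) {s₀ : Fin (n G)} (e₀ : E v s₀) where

      isochromatic : Isochromatic G G′
      isochromatic k = mk⇔ (from′ ∘ to) (from ∘ to′)
        where
        open Equivalence (bipartite-edge⇒chromatic-2 {G} bip e₀ k)
        open Equivalence (bipartite-edge⇒chromatic-2 {G′} (proj₂ bipartite′) (adj⇒edge {old v} {hub} (forth refl)) k)
          renaming (to to to′; from to from′)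

      helly : ∃[ s ] (E v s × SideWithin G col (not i) s R)
      helly with proj₂ ar G′ bipartite′ embed embedding isometric isochromatic
      ... | ρ , ρ-edge , ρ-embed = ρ (encode hub) , v-edge , within
        where
        v-edge : E v (ρ (encode hub))
        v-edge = subst (λ z → E z (ρ (encode hub))) (ρ-embed v) (ρ-edge _ _ (adj⇒edge {old v} {hub} (forth refl)))
        within : SideWithin G col (not i) (ρ (encode hub)) R
        within u cu = R , ≤-refl , reverseʷ E-sym (subst (λ z → Walk E (ρ (encode hub)) z R) (ρ-embed u)
          (mapʷ ρ (λ {a} {b} → ρ-edge a b) (mapʷ encode (λ {a} {b} → adj⇒edge {a} {b}) (hub-walk cu))))

absolute-retract⇒neighbour-helly : ∀ {G col} (bip : IsBipartition G col) → Connected G →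
  AbsoluteRetractOfBipartite G → ∀ {i v} → col v ≡ i → (∃[ c ] col c ≡ not i) → ∀ ℓ →
  SideWithin G col (not i) v (suc (2 * ℓ)) →
  (∀ u → col u ≡ not i → SideWithin G col (not i) u (2 * ℓ + 2 * ℓ)) →
  ∃[ s ] (Edge G v s × SideWithin G col (not i) s (2 * ℓ))
absolute-retract⇒neighbour-helly {G} {col} bip conn ar {i} {v} cv (c₀ , cc₀) zero far close
  with far c₀ cc₀
... | _ , _ , here = contradiction (trans (sym cv) cc₀) (not-¬ refl)
... | _ , _ , step e here = c₀ , Halved.E-sym G col bip e , close c₀ cc₀
... | _ , s≤s () , step _ (step _ _)
absolute-retract⇒neighbour-helly {G} {col} bip conn ar {i} {v} cv (c₀ , cc₀) (suc q) far close
  with far c₀ cc₀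
... | _ , _ , w with walk⇒halved-to-neighbour cv cc₀ w
  where open Halved G col bip
...   | s₀ , e₀ , _ =
  let (s , e , within) = helly conn (subst (λ m → SideWithin G col (not i) v (suc m)) (*-suc 2 q) far)
                                     (λ u cu → subst (λ m → SideWithin G col (not i) u (m + m)) (*-suc 2 q) (close u cu))
                                     ar e₀
  in s , e , subst (SideWithin G col (not i) s) (sym (*-suc 2 q)) within
  where open Gadget G col bip cv q

module AtVertex (G : Graph) (col : Fin (n G) → Bool) (bip : IsBipartition G col) (conn : Connected G)
                {i : Bool} {v : Fin (n G)} (cv : col v ≡ i) {e : ℕ} (eccH : EccH G col i v e) where
  open Halved G col bip

  same-side-within : SideWithin G col i v (2 * e)
  same-side-within u cu with ecc⇒within eccH cu
  ... | j , j≤e , hw = 2 * j , *-monoʳ-≤ 2 j≤e , halved⇒walk hw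

  other-side-within : SideWithin G col (not i) v (suc (2 * e))
  other-side-within u cu with conn u v
  ... | _ , here = contradiction (trans (sym cv) cu) (not-¬ refl)
  ... | _ , step {w = w} e′ _ with same-side-within w (trans (col-flip e′) (trans (cong not cu) (not-involutive i)))
  ...   | l , l≤2e , w′ = suc l , s≤s l≤2e , step e′ w′

  neighbour-side : ∀ {s} → E v s → col s ≡ not i
  neighbour-side e′ = trans (col-flip e′) (cong not cv)

  all-within : ∀ {m} → 2 * e ≤ m → SideWithin G col (not i) v m → ∀ u → AllV u → Within E u v m
  all-within {m} 2e≤m other u _ with col u Bool.≟ i
  ... | yes cu = within-weaken 2e≤m (same-side-within u cu)
  ... | no ¬cu = other u (¬-not ¬cu)

  module _ {eG : ℕ} (eccG : EccG G v eG) where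

    eccG-lower : 2 * e ≤ eG
    eccG-lower with proj₂ eccH
    ... | w₀ , cw₀ , d with proj₁ eccG w₀ _
    ...   | j , (w , _) , j≤eG with walk⇒halved w cw₀ cv
    ...     | j′ , 2j′≤j , hw = ≤-trans (*-monoʳ-≤ 2 (dist≤walk d hw)) (≤-trans 2j′≤j j≤eG)

    eccG-upper : eG ≤ suc (2 * e)
    eccG-upper = ecc≤bound eccG (all-within (n≤1+n _) other-side-within)

    eccG≡2e⇔ : eG ≡ 2 * e ⇔ SideWithin G col (not i) v (2 * e)
    eccG≡2e⇔ = mk⇔ (λ { refl u _ → ecc⇒within eccG _ })
                   (λ other → ≤-antisym (ecc≤bound eccG (all-within ≤-refl other)) eccG-lower)

    eccG≢2e : ¬ eG ≡ 2 * e → eG ≡ 2 * e + 1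
    eccG≢2e eG≢2e with m≤n⇒m<n∨m≡n eccG-upper
    ... | inj₁ eG<2e+1 = contradiction (≤-antisym (≤-pred eG<2e+1) eccG-lower) eG≢2e
    ... | inj₂ eG≡2e+1 = trans eG≡2e+1 (+-comm 1 _)

  module _ {r : ℕ} (radH : RadH G col (not i) r) where

    centre : Fin (n G)
    centre = proj₁ (proj₁ radH)

    centre-side : col centre ≡ not i
    centre-side = proj₁ (proj₂ (proj₁ radH))

    centre-ecc : EccH G col (not i) centre r
    centre-ecc = proj₂ (proj₂ (proj₁ radH))

    some-neighbour : ∃[ s ] E v s
    some-neighbour with other-side-within centre centre-side
    ... | _ , _ , w = let (s , e′ , _) = walk⇒halved-to-neighbour cv centre-side w in s , e′

    neighbour-eccH : ∀ {s} B → SideWithin G col (not i) v (2 * B) → E v s →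
                     ∃[ k ] (k ≤ B × EccH G col (not i) s k)
    neighbour-eccH B other e′ = side-within⇒eccH B (neighbour-side e′) (side-within-step e′ other)

    radius≤ : ∀ {s} B → SideWithin G col (not i) v (2 * B) → E v s → r ≤ B
    radius≤ B other e′ =
      let (k , k≤B , ecc) = neighbour-eccH B other e′ in ≤-trans (proj₂ radH _ (neighbour-side e′) k ecc) k≤B

    neighbour-below-radius : AbsoluteRetractOfBipartite G → ∀ {ℓ} → r ≤ ℓ →
      SideWithin G col (not i) v (2 * suc ℓ) → ∃[ s ] (E v s × ∃[ k ] (EccH G col (not i) s k × k ≤ ℓ))
    neighbour-below-radius ar {ℓ} r≤ℓ other
      with absolute-retract⇒neighbour-helly {G} {col} bip conn ar cv (centre , centre-side) ℓ
             (side-within-odd cv other)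
             (λ u cu → side-within-weaken {G} {col} (+-mono-≤ (*-monoʳ-≤ 2 r≤ℓ) (*-monoʳ-≤ 2 r≤ℓ))
                                          (eccH⇒pairwise-within centre-ecc u cu))
    ... | s , e′ , within =
      let (k , k≤ℓ , ecc) = side-within⇒eccH ℓ (neighbour-side e′) (side-within-weaken {G} {col} (n≤1+n _) within)
      in s , e′ , k , ecc , k≤ℓ

    module _ {eG : ℕ} (eccG : EccG G v eG) where
      open Equivalence (eccG≡2e⇔ eccG) using () renaming (to to eG≡2e⇒within; from to within⇒eG≡2e)

      below-radius : e < r → (eG ≡ 2 * e + 1) × (eG + 1 ≡ 2 * r)
      below-radius e<r = eG≡2e+1 , (begin
        eG + 1            ≡⟨ cong (_+ 1) eG≡2e+1 ⟩
        2 * e + 1 + 1     ≡⟨ +-comm (2 * e + 1) 1 ⟩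
        suc (2 * e + 1)   ≡⟨ cong suc (+-comm (2 * e) 1) ⟩
        suc (suc (2 * e)) ≡⟨ sym (*-suc 2 e) ⟩
        2 * suc e         ≡⟨ cong (2 *_) (≤-antisym e<r r≤1+e) ⟩
        2 * r             ∎)
        where
        open ≡-Reasoning
        e′ : E v (proj₁ some-neighbour)
        e′ = proj₂ some-neighbour
        r≤1+e : r ≤ suc e
        r≤1+e = radius≤ (suc e) (side-within-weaken {G} {col} (≤-trans (n≤1+n _) (≤-reflexive (sym (*-suc 2 e)))) other-side-within) e′
        eG≡2e+1 : eG ≡ 2 * e + 1
        eG≡2e+1 = eccG≢2e eccG (λ eG≡2e → <⇒≱ e<r (radius≤ e (eG≡2e⇒within eG≡2e) e′))

      at-radius : e ≡ r →
        ((eG ≡ 2 * r) ⇔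
          ((∀ u → Edge G v u → CentreH G col (not i) u)
           × (∀ u → col u ≡ not i → ∃[ s ] (Edge G v s × ∃[ j ] (DistH G col (not i) u s j × j < r)))))
        × (¬ (eG ≡ 2 * r) → eG ≡ 2 * r + 1)
      at-radius refl = mk⇔ (λ eG≡2e → centred (eG≡2e⇒within eG≡2e) , reached (eG≡2e⇒within eG≡2e))
                           (reached⇒eG≡2e ∘ proj₂) ,
                       eccG≢2e eccG
        where
        centred : SideWithin G col (not i) v (2 * e) → ∀ s → E v s → CentreH G col (not i) s
        centred other s e′ =
          let (k , k≤e , ecc) = neighbour-eccH e other e′
          in neighbour-side e′ , e , radH ,
             subst (EccH G col (not i) s) (≤-antisym k≤e (proj₂ radH s (neighbour-side e′) k ecc)) ecc
        reached : SideWithin G col (not i) v (2 * e) →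
                  ∀ u → col u ≡ not i → ∃[ s ] (E v s × ∃[ j ] (DistH G col (not i) u s j × j < e))
        reached other u cu with other u cu
        ... | l , l≤2e , w with walk⇒halved-to-neighbour cv cu w
        ...   | s , e′ , j , 2j+1≤l , hw with HW.within⇒dist (not i) (j , ≤-refl , hw)
        ...     | j′ , j′≤j , d = s , e′ , j′ , d , ≤-<-trans j′≤j (half-< {j} (≤-trans 2j+1≤l l≤2e))
        reached⇒eG≡2e : (∀ u → col u ≡ not i → ∃[ s ] (E v s × ∃[ j ] (DistH G col (not i) u s j × j < e))) →
                        eG ≡ 2 * e
        reached⇒eG≡2e reach = within⇒eG≡2e λ u cu →
          let (s , e′ , j , (hw , _) , j<e) = reach u cu
          in suc (2 * j) , <⇒≤ (double-< j<e) , halved⇒walk hw ▷ E-sym e′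

      above-radius : AbsoluteRetractOfBipartite G → r < e →
        ((eG ≡ 2 * e) ⇔ (∃[ s ] (Edge G v s × ∃[ k ] (EccH G col (not i) s k × k < e))))
        × (¬ (eG ≡ 2 * e) → eG ≡ 2 * e + 1)
      above-radius ar r<e = mk⇔ (helly-neighbour r<e ∘ eG≡2e⇒within) ecc⇒eG≡2e , eccG≢2e eccG
        where
        ecc⇒eG≡2e : ∃[ s ] (E v s × ∃[ k ] (EccH G col (not i) s k × k < e)) → eG ≡ 2 * e
        ecc⇒eG≡2e (s , e′ , k , ecc , k<e) = within⇒eG≡2e λ u cu →
          let (j , j≤k , hw) = ecc⇒within ecc cu
          in suc (2 * j) , <⇒≤ (double-< (≤-<-trans j≤k k<e)) , halved⇒walk hw ▷ E-sym e′
        helly-neighbour : r < e → SideWithin G col (not i) v (2 * e) →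
                          ∃[ s ] (E v s × ∃[ k ] (EccH G col (not i) s k × k < e))
        helly-neighbour r<e other =
          let (ℓ , e≡1+ℓ , r≤ℓ) = <-predecessor r<e
              (s , e′ , k , ecc , k≤ℓ) = neighbour-below-radius ar r≤ℓ
                                           (subst (λ m → SideWithin G col (not i) v (2 * m)) e≡1+ℓ other)
          in s , e′ , k , ecc , subst (k <_) (sym e≡1+ℓ) (s≤s k≤ℓ)

lemma24 : (G : Graph) → (col : Fin (n G) → Bool) → IsBipartition G col →
    0 < n G → Connected G → AbsoluteRetractOfBipartite G →
    ∀ (i : Bool) (v : Fin (n G)) → col v ≡ i →
    ∀ (eH r eG : ℕ) → EccH G col i v eH → RadH G col (not i) r → EccG G v eG →
    ((eH < r → (eG ≡ 2 * eH + 1) × (eG + 1 ≡ 2 * r))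
    × (eH ≡ r →
        ((eG ≡ 2 * r) ⇔
          ((∀ u → Edge G v u → CentreH G col (not i) u)
           × (∀ u → col u ≡ not i →
                ∃[ s ] (Edge G v s × ∃[ j ] (DistH G col (not i) u s j × j < r)))))
        × (¬ (eG ≡ 2 * r) → eG ≡ 2 * r + 1))
    × (r < eH →
        ((eG ≡ 2 * eH) ⇔
          (∃[ u ] (Edge G v u × ∃[ k ] (EccH G col (not i) u k × k < eH))))
        × (¬ (eG ≡ 2 * eH) → eG ≡ 2 * eH + 1)))
lemma24 G col bip _ conn ar i v cv eH r eG eccH radH eccG =
  below-radius radH eccG , at-radius radH eccG , above-radius radH eccG ar
  where open AtVertex G col bip conn cv eccH
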